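{- Let $b$ be a positive integer and let $\gamma_{0,b,1} = b+1, b, \ldots, 2, b+2, 1 \in S_{b+2}$. Then $$|S_n(132, 123, \gamma_{0,b,1})| = \sum_{k=1}^n F_{b,k} \qquad (n \ge 1),$$ and $$\sum_{n=0}^\infty |S_n(132, 123, \gamma_{0,b,1})| x^n = 1 + \frac{x}{1-2x+x^{b+1}}.$$
   Context: $S_n$ is the set of permutations of $\{1,\dots,n\}$ in one-line notation; $\pi$ avoids $\sigma\in S_k$ if no subsequence of $\pi$ of length $k$ has the same relative order as $\sigma$; $S_n(R)$ is the set of $\pi\in S_n$ avoiding every element of $R$, and $S_0(R)$ contains only the empty permutation. For $k\ge1$, $F_{k,n}=0$ for $n\le 0$, $F_{k,1}=1$, and $F_{k,n}=\sum_{i=1}^k F_{k,n-i}$ for $n \ge 2$. -}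

module Defs where

open import Data.Nat using (ℕ; zero; suc; _+_; _<_)
open import Data.Fin using (Fin; toℕ) renaming (_<_ to _<ᶠ_)
open import Data.Vec using (Vec; []; _∷_; lookup; _++_)
open import Data.List as List using (List; take)
open import Data.Nat.ListAction using (sum)
open import Data.Integer as ℤ using (ℤ)
open import Data.Product using (Σ; _×_)
open import Data.Refinement using (Refinement-syntax)
open import Function.Bundles using (_⇔_)
open import Function.Definitions using (Injective)
open import Relation.Binary.PropositionalEquality using (_≡_)
open import Relation.Nullary using (¬_)
open import Relation.Nullary.Decidable using (does)

-- An element of S_n is a vector π of length n over Fin n (values
-- 0,…,n-1 stand for 1,…,n; only relative order matters) such that
-- i ↦ π(i) is injective (hence bijective).

IsPerm : ∀ {n} → Vec (Fin n) n → Set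
IsPerm π = Injective _≡_ _≡_ (lookup π)

Contains : ∀ {k n} → Vec ℕ k → Vec (Fin n) n → Set
Contains {k} {n} σ π =
  Σ (Fin k → Fin n) λ f →
    (∀ a b → a <ᶠ b → f a <ᶠ f b) ×
    (∀ a b → (lookup σ a < lookup σ b) ⇔ (toℕ (lookup π (f a)) < toℕ (lookup π (f b))))

Avoids : ∀ {k n} → Vec (Fin n) n → Vec ℕ k → Set
Avoids π σ = ¬ Contains σ π

p132 : Vec ℕ 3
p132 = 1 ∷ 3 ∷ 2 ∷ []

p123 : Vec ℕ 3
p123 = 1 ∷ 2 ∷ 3 ∷ []

desc : (m : ℕ) → Vec ℕ m
desc zero = []
desc (suc m) = suc (suc m) ∷ desc m

gamma : (b : ℕ) → Vec ℕ (b + 2)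
gamma b = desc b ++ (b + 2 ∷ 1 ∷ [])

-- S_n(132, 123, γ_{0,b,1}) as a set (proof-irrelevant refinement, so
-- two elements are equal iff their underlying one-line vectors are equal)
Av : (b n : ℕ) → Set
Av b n = [ π ∈ Vec (Fin n) n ∣ IsPerm π × Avoids π p132 × Avoids π p123 × Avoids π (gamma b) ]

-- k-generalized Fibonacci numbers F_{k,n}:
-- F_{k,n} = 0 (n ≤ 0), F_{k,1} = 1, F_{k,n} = Σ_{i=1}^k F_{k,n-i} (n ≥ 2).
-- hist k n = [F_{k,n}, F_{k,n-1}, …, F_{k,0}]; terms with negative index are 0,
-- so summing the first k entries of hist k (n+1) gives F_{k,n+2}.

hist : ℕ → ℕ → List ℕ
hist k zero = 0 List.∷ List.[]
hist k (suc zero) = 1 List.∷ 0 List.∷ List.[]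
hist k (suc (suc n)) = sum (take k (hist k (suc n))) List.∷ hist k (suc n)

F : ℕ → ℕ → ℕ
F k n = sum (take 1 (hist k n))

sumF : ℕ → ℕ → ℕ
sumF b zero = 0
sumF b (suc n) = sumF b n + F b (suc n)

Series : Set
Series = ℕ → ℤ

-- Σ_{i=0}^{n} f i * g (n - i)
conv : Series → Series → ℕ → ℕ → ℤ
conv f g zero m = f zero ℤ.* g m
conv f g (suc i) m = f (suc i) ℤ.* g m ℤ.+ conv f g i (suc m)

_⊛_ : Series → Series → Series
(f ⊛ g) n = conv f g n 0

_⊕_ : Series → Series → Series
(f ⊕ g) n = f n ℤ.+ g n

_⊖_ : Series → Series → Series
(f ⊖ g) n = f n ℤ.- g n

scale : ℤ → Series → Series
scale c f n = c ℤ.* f n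

X^ : ℕ → Series
X^ m n = if does (m Data.Nat.≟ n) then ℤ.1ℤ else ℤ.0ℤ
  where open import Data.Bool using (if_then_else_)
        import Data.Nat

ofℕ : (ℕ → ℕ) → Series
ofℕ a n = ℤ.+ (a n)

-- In π ∈ S_{n+1} avoiding 132 and 123, every entry before the maximum exceeds every entry after it
-- (else 132) and the entries before it decrease (else 123).  So π is the maximum at some position j,
-- preceded by a decreasing run of the next j values and followed by a pattern τ ∈ S_{n-j} that avoids
-- the same patterns, and every such pair (j, τ) gives an avoider.  The pattern γ_{0,b,1} then occurs in
-- π exactly when it occurs in τ, or when j ≥ b and τ is nonempty.  Counting the admissible j gives
-- a_{n+1} = 1 + a_n + a_{n-1} + ⋯ (min(b, n) terms from a), the recurrence satisfied by the partial
-- sums S_n = Σ_{k ≤ n} F_{b,k}; and S_{n+2} - 2 S_{n+1} + S_{n+1-b} = 0 is the coefficientwise form of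
-- the generating-function identity.
module Submission where

open import Defs

open import Data.Empty using (⊥; ⊥-elim)
open import Data.Fin as Fin using (Fin; toℕ; fromℕ<) renaming (_<_ to _<ᶠ_)
open import Data.Fin.Patterns using (0F; 1F; 2F)
open import Data.Fin.Permutation using (↔⇒≡)
open import Data.Fin.Properties using (1↔⊤; +↔⊎; toℕ-injective; toℕ<n; toℕ-fromℕ<; toℕ-inject₁; injective⇒≤)
open import Data.Integer as ℤ using (+_)
import Data.Integer.Properties as ℤP
import Data.Integer.Solver as ℤS
open import Data.Irrelevant as Irr using (Irrelevant; [_])
open import Data.List as List using (take)
open import Data.Nat using (ℕ; zero; suc; pred; _+_; _∸_; _<_; _≤_; _≟_; _<?_; z≤n; s≤s; s≤s⁻¹; s<s⁻¹)
open import Data.Nat.Induction using (<-rec)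
open import Data.Nat.ListAction using (sum)
open import Data.Nat.Properties
open import Data.Nat.Solver using (module +-*-Solver)
open import Data.Product using (_×_; _,_)
open import Data.Refinement using (_,_; value)
open import Data.Refinement.Properties using (value-injective)
open import Data.Sum using (_⊎_; inj₁; inj₂)
open import Data.Sum.Function.Propositional using (_⊎-↔_)
open import Data.Unit using (⊤; tt)
open import Data.Vec using (Vec; []; _∷_; lookup; tabulate; _++_)
open import Data.Vec.Properties using (lookup-++-<; ≡-dec)
open import Function using (_∘_)
open import Function.Bundles using (_⇔_; mk⇔; Equivalence; _↔_; mk↔ₛ′)
open import Function.Construct.Composition using (_↔-∘_)
open import Function.Construct.Symmetry using (↔-sym)
open import Relation.Binary.Definitions using (tri<; tri≈; tri>)
open import Relation.Binary.PropositionalEquality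
open import Relation.Nullary using (¬_; yes; no)
open import Relation.Nullary.Decidable using (recompute)

valueAt : ∀ {k l} → Vec (Fin k) l → ℕ → ℕ
valueAt []       _       = 0
valueAt (y ∷ _)  zero    = toℕ y
valueAt (_ ∷ ys) (suc x) = valueAt ys x

valueAt-lookup : ∀ {k l} (v : Vec (Fin k) l) (i : Fin l) → valueAt v (toℕ i) ≡ toℕ (lookup v i)
valueAt-lookup (_ ∷ _)  Fin.zero    = refl
valueAt-lookup (_ ∷ ys) (Fin.suc i) = valueAt-lookup ys i

valueAt-tabulate : ∀ {k l} (f : Fin l → Fin k) {x} (x<l : x < l) →
                   valueAt (tabulate f) x ≡ toℕ (f (fromℕ< x<l))
valueAt-tabulate f {zero}  (s≤s _)   = refl
valueAt-tabulate f {suc x} (s≤s x<l) = valueAt-tabulate (f ∘ Fin.suc) x<l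

valueAt< : ∀ {k l} (v : Vec (Fin k) l) {x} → x < l → valueAt v x < k
valueAt< (y ∷ _)  {zero}  _       = toℕ<n y
valueAt< (_ ∷ ys) {suc x} (s≤s p) = valueAt< ys p

≡-byValueAt : ∀ {k l} (u v : Vec (Fin k) l) → (∀ x → x < l → valueAt u x ≡ valueAt v x) → u ≡ v
≡-byValueAt []       []       _ = refl
≡-byValueAt (y ∷ ys) (z ∷ zs) h =
  cong₂ _∷_ (toℕ-injective (h 0 (s≤s z≤n))) (≡-byValueAt ys zs (λ x p → h (suc x) (s≤s p)))

InjectiveOn : ∀ {N} → Vec (Fin N) N → Set
InjectiveOn {N} π = ∀ x y → x < N → y < N → valueAt π x ≡ valueAt π y → x ≡ y

isPerm⇒injectiveOn : ∀ {N} (π : Vec (Fin N) N) → IsPerm π → InjectiveOn π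
isPerm⇒injectiveOn π perm x y x<N y<N e = begin
  x                      ≡⟨ toℕ-fromℕ< x<N ⟨
  toℕ (fromℕ< x<N)       ≡⟨ cong toℕ (perm (toℕ-injective lookups≡)) ⟩
  toℕ (fromℕ< y<N)       ≡⟨ toℕ-fromℕ< y<N ⟩
  y                      ∎
  where
  open ≡-Reasoning
  valueAt≡ : ∀ {z} (z<N : z < _) → toℕ (lookup π (fromℕ< z<N)) ≡ valueAt π z
  valueAt≡ z<N = trans (sym (valueAt-lookup π _)) (cong (valueAt π) (toℕ-fromℕ< z<N))
  lookups≡ : toℕ (lookup π (fromℕ< x<N)) ≡ toℕ (lookup π (fromℕ< y<N))
  lookups≡ = trans (valueAt≡ x<N) (trans e (sym (valueAt≡ y<N)))

injectiveOn⇒isPerm : ∀ {N} (π : Vec (Fin N) N) → InjectiveOn π → IsPerm π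
injectiveOn⇒isPerm π inj {i} {i′} e = toℕ-injective (inj (toℕ i) (toℕ i′) (toℕ<n i) (toℕ<n i′)
  (trans (valueAt-lookup π i) (trans (cong toℕ e) (sym (valueAt-lookup π i′)))))

injectiveOn-bounded⇒≤ : ∀ {N k v} (π : Vec (Fin N) N) → InjectiveOn π → (pos : Fin k → ℕ) →
                        (∀ {i i′} → pos i ≡ pos i′ → i ≡ i′) → (∀ i → pos i < N) →
                        (∀ i → valueAt π (pos i) < v) → k ≤ v
injectiveOn-bounded⇒≤ π inj pos pos-injective pos< bounded = injective⇒≤ {f = toValue} λ {i} {i′} e →
  pos-injective (inj _ _ (pos< i) (pos< i′)
    (trans (sym (toℕ-fromℕ< (bounded i))) (trans (cong toℕ e) (toℕ-fromℕ< (bounded i′)))))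
  where
  toValue : Fin _ → Fin _
  toValue i = fromℕ< (bounded i)

OrderIsomorphic : ∀ {K} → Vec ℕ K → (Fin K → ℕ) → Set
OrderIsomorphic σ w = ∀ a c → (lookup σ a < lookup σ c) ⇔ (w a < w c)

StrictlyIncreasing : ∀ {K} → (Fin K → ℕ) → Set
StrictlyIncreasing f = ∀ a c → a <ᶠ c → f a < f c

index≤ : ∀ {K} (f : Fin K → ℕ) → StrictlyIncreasing f → ∀ a → toℕ a ≤ f a
index≤ f mono Fin.zero    = z≤n
index≤ f mono (Fin.suc a) = ≤-<-trans (index≤ (f ∘ Fin.inject₁) mono∘inject₁ a)
                                       (mono (Fin.inject₁ a) (Fin.suc a) (s≤s (≤-reflexive (toℕ-inject₁ a))))
  where
  mono∘inject₁ : StrictlyIncreasing (f ∘ Fin.inject₁)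
  mono∘inject₁ a c a<c = mono _ _ (subst₂ _<_ (sym (toℕ-inject₁ a)) (sym (toℕ-inject₁ c)) a<c)

first≤ : ∀ {K} (f : Fin (suc K) → ℕ) → StrictlyIncreasing f → ∀ a → f Fin.zero ≤ f a
first≤ f mono Fin.zero    = ≤-refl
first≤ f mono (Fin.suc a) = <⇒≤ (mono Fin.zero (Fin.suc a) (s≤s z≤n))

record Occurrence {K N} (σ : Vec ℕ K) (π : Vec (Fin N) N) : Set where
  field
    pos      : Fin K → ℕ
    pos<     : ∀ a → pos a < N
    pos-mono : StrictlyIncreasing pos
    order    : OrderIsomorphic σ (valueAt π ∘ pos)

orderIsomorphic-cong : ∀ {K} (σ : Vec ℕ K) {v w : Fin K → ℕ} →
                       (∀ a → v a ≡ w a) → OrderIsomorphic σ v → OrderIsomorphic σ w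
orderIsomorphic-cong σ e iso a c = subst₂ (λ x y → _ ⇔ (x < y)) (e a) (e c) (iso a c)

contains⇒occurrence : ∀ {K N} (σ : Vec ℕ K) (π : Vec (Fin N) N) → Contains σ π → Occurrence σ π
contains⇒occurrence σ π (f , mono , iso) = record
  { pos      = λ a → toℕ (f a)
  ; pos<     = λ a → toℕ<n (f a)
  ; pos-mono = mono
  ; order    = orderIsomorphic-cong σ (λ a → sym (valueAt-lookup π (f a))) iso
  }

occurrence⇒contains : ∀ {K N} (σ : Vec ℕ K) (π : Vec (Fin N) N) → Occurrence σ π → Contains σ π
occurrence⇒contains σ π o = f , mono , orderIsomorphic-cong σ values order
  where
  open Occurrence o
  f = λ a → fromℕ< (pos< a)
  toℕ-f : ∀ a → toℕ (f a) ≡ pos a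
  toℕ-f a = toℕ-fromℕ< (pos< a)
  mono : ∀ a c → a <ᶠ c → f a <ᶠ f c
  mono a c a<c = subst₂ _<_ (sym (toℕ-f a)) (sym (toℕ-f c)) (pos-mono a c a<c)
  values : ∀ a → valueAt π (pos a) ≡ toℕ (lookup π (f a))
  values a = trans (cong (valueAt π) (sym (toℕ-f a))) (valueAt-lookup π (f a))

record Avoider (b : ℕ) {N} (π : Vec (Fin N) N) : Set where
  field
    injective : InjectiveOn π
    avoids132 : ¬ Occurrence p132 π
    avoids123 : ¬ Occurrence p123 π
    avoidsγ   : ¬ Occurrence (gamma b) π

InAv : ℕ → ∀ {N} → Vec (Fin N) N → Set
InAv b π = IsPerm π × Avoids π p132 × Avoids π p123 × Avoids π (gamma b)

inAv⇒avoider : ∀ b {N} (π : Vec (Fin N) N) → InAv b π → Avoider b π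
inAv⇒avoider b π (perm , a132 , a123 , aγ) = record
  { injective = isPerm⇒injectiveOn π perm
  ; avoids132 = a132 ∘ occurrence⇒contains p132 π
  ; avoids123 = a123 ∘ occurrence⇒contains p123 π
  ; avoidsγ   = aγ ∘ occurrence⇒contains (gamma b) π
  }

avoider⇒inAv : ∀ b {N} (π : Vec (Fin N) N) → Avoider b π → InAv b π
avoider⇒inAv b π av =
    injectiveOn⇒isPerm π injective
  , avoids132 ∘ contains⇒occurrence p132 π
  , avoids123 ∘ contains⇒occurrence p123 π
  , avoidsγ ∘ contains⇒occurrence (gamma b) π
  where open Avoider av

-- A relabelling only needs to be increasing on 1, 2, …, the alphabet of patterns.
IncreasingFrom1 : (ℕ → ℕ) → Set
IncreasingFrom1 φ = ∀ {u v} → 1 ≤ u → u < v → φ u < φ v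

increasingFrom1⇒<⇔ : ∀ {φ} → IncreasingFrom1 φ → ∀ {u v} → 1 ≤ u → 1 ≤ v → (u < v) ⇔ (φ u < φ v)
increasingFrom1⇒<⇔ {φ} mono {u} {v} 1≤u 1≤v = mk⇔ (mono 1≤u) reflect
  where
  reflect : φ u < φ v → u < v
  reflect φu<φv with <-cmp u v
  ... | tri< u<v _ _ = u<v
  ... | tri≈ _ refl _ = ⊥-elim (<-irrefl refl φu<φv)
  ... | tri> _ _ v<u = ⊥-elim (<-asym φu<φv (mono 1≤v v<u))

occurrence-byRelabelling : ∀ {K N} (σ : Vec ℕ K) (π : Vec (Fin N) N) (pos : Fin K → ℕ) →
  (∀ a → pos a < N) → StrictlyIncreasing pos → (∀ a → 1 ≤ lookup σ a) →
  (φ : ℕ → ℕ) → IncreasingFrom1 φ → (∀ a → valueAt π (pos a) ≡ φ (lookup σ a)) → Occurrence σ π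
occurrence-byRelabelling σ π pos pos< mono positive φ φ-mono values = record
  { pos      = pos
  ; pos<     = pos<
  ; pos-mono = mono
  ; order    = orderIsomorphic-cong σ (sym ∘ values)
                 (λ a c → increasingFrom1⇒<⇔ φ-mono (positive a) (positive c))
  }

-- Data.Nat.compare with its indices turned into equations, so that j may stay a fixed parameter.
data Comparison (x j : ℕ) : Set where
  below : ∀ d → j ≡ suc (x + d) → Comparison x j
  at    : x ≡ j → Comparison x j
  above : ∀ y → x ≡ suc (j + y) → Comparison x j

comparison : ∀ x j → Comparison x j
comparison zero    zero    = at refl
comparison zero    (suc j) = below j refl
comparison (suc x) zero    = above x refl
comparison (suc x) (suc j) with comparison x j
... | below d e = below d (cong suc e)
... | at e      = at (cong suc e)
... | above y e = above y (cong suc e)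

below⇒< : ∀ {x j d} → j ≡ suc (x + d) → x < j
below⇒< {x} {d = d} refl = s≤s (m≤m+n x d)

below⇒gap< : ∀ {x j d} → j ≡ suc (x + d) → d < j
below⇒gap< {x} {d = d} refl = s≤s (m≤n+m d x)

above⇒> : ∀ {x j y} → x ≡ suc (j + y) → j < x
above⇒> {j = j} {y} refl = s≤s (m≤m+n j y)

lookup-++-offset : ∀ {A : Set} {k l} (xs : Vec A k) (ys : Vec A l) (a : Fin (k + l)) (i : Fin l) →
                   toℕ a ≡ k + toℕ i → lookup (xs ++ ys) a ≡ lookup ys i
lookup-++-offset []       ys a           i e  = cong (lookup ys) (toℕ-injective e)
lookup-++-offset (_ ∷ xs) ys (Fin.suc a) i e  = lookup-++-offset xs ys a i (suc-injective e)

lookup-desc : ∀ {b d} (i : Fin b) → b ≡ suc (toℕ i + d) → lookup (desc b) i ≡ suc (suc d)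
lookup-desc {suc b} Fin.zero    e = cong suc e
lookup-desc {suc b} (Fin.suc i) e = lookup-desc i (suc-injective e)

gamma-below : ∀ b (a : Fin (b + 2)) {d} → b ≡ suc (toℕ a + d) → lookup (gamma b) a ≡ suc (suc d)
gamma-below b a {d} e = trans (lookup-++-< (desc b) _ a a<b)
  (lookup-desc (fromℕ< a<b) (trans e (cong (λ z → suc (z + d)) (sym (toℕ-fromℕ< a<b)))))
  where a<b = below⇒< e

gamma-at : ∀ b (a : Fin (b + 2)) → toℕ a ≡ b → lookup (gamma b) a ≡ b + 2
gamma-at b a e = lookup-++-offset (desc b) _ a Fin.zero (trans e (sym (+-identityʳ b)))

gamma-above : ∀ b (a : Fin (b + 2)) {y} → toℕ a ≡ suc (b + y) → lookup (gamma b) a ≡ 1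
gamma-above b a {y} e = lookup-++-offset (desc b) _ a (Fin.suc Fin.zero)
  (trans e (trans (cong (λ z → suc (b + z)) y≡0) (sym (+-suc b 0))))
  where
  y≡0 : y ≡ 0
  y≡0 = n<1⇒n≡0 (s<s⁻¹ (+-cancelˡ-< b (suc y) 2
          (subst (_< b + 2) (trans e (sym (+-suc b y))) (toℕ<n a))))

gamma-positive : ∀ b (a : Fin (b + 2)) → 1 ≤ lookup (gamma b) a
gamma-positive b a with comparison (toℕ a) b
... | below _ e = subst (1 ≤_) (sym (gamma-below b a e)) (s≤s z≤n)
... | at e      = subst (1 ≤_) (sym (gamma-at b a e)) (≤-trans (s≤s z≤n) (m≤n+m 2 b))
... | above _ e = subst (1 ≤_) (sym (gamma-above b a e)) ≤-refl

above⇒offset< : ∀ {j m x y} → x ≡ suc (j + y) → x < suc (j + m) → y < m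
above⇒offset< {j} {m} {y = y} refl (s≤s p) = +-cancelˡ-< j y m p

above-pos< : ∀ {j m y} → y < m → suc (j + y) < suc (j + m)
above-pos< {j} y<m = s≤s (+-monoʳ-< j y<m)

-- shape j m τ is the permutation (j+m-1, j+m-2, …, m, j+m, τ) of {0, …, j+m}: maximum at position j.
module Shape (j m : ℕ) (τ : Vec (Fin m) m) where

  N : ℕ
  N = suc (j + m)

  shapeValue : ℕ → ℕ
  shapeValue x with comparison x j
  ... | below d _ = d + m
  ... | at _      = j + m
  ... | above y _ = valueAt τ y

  shapeValue-below : ∀ {x d} → j ≡ suc (x + d) → shapeValue x ≡ d + m
  shapeValue-below {x} {d} e with comparison x j
  ... | below d′ e′ = cong (_+ m) (+-cancelˡ-≡ x d′ d (suc-injective (trans (sym e′) e)))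
  ... | at e′       = ⊥-elim (<-irrefl e′ (below⇒< e))
  ... | above _ e′  = ⊥-elim (<-asym (below⇒< e) (above⇒> e′))

  shapeValue-at : ∀ {x} → x ≡ j → shapeValue x ≡ j + m
  shapeValue-at {x} e with comparison x j
  ... | below _ e′ = ⊥-elim (<-irrefl e (below⇒< e′))
  ... | at _       = refl
  ... | above _ e′ = ⊥-elim (<-irrefl (sym e) (above⇒> e′))

  shapeValue-above : ∀ {x y} → x ≡ suc (j + y) → shapeValue x ≡ valueAt τ y
  shapeValue-above {x} {y} e with comparison x j
  ... | below _ e′  = ⊥-elim (<-asym (below⇒< e′) (above⇒> e))
  ... | at e′       = ⊥-elim (<-irrefl (sym e′) (above⇒> e))
  ... | above y′ e′ = cong (valueAt τ) (+-cancelˡ-≡ j y′ y (suc-injective (trans (sym e′) e)))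

  j<N : j < N
  j<N = s≤s (m≤m+n j m)

  shapeValue<N : ∀ {x} → x < N → shapeValue x < N
  shapeValue<N {x} x<N with comparison x j
  ... | below d e = s≤s (+-monoˡ-≤ m (<⇒≤ (below⇒gap< e)))
  ... | at _      = ≤-refl
  ... | above y e = <-≤-trans (valueAt< τ (above⇒offset< e x<N)) (m≤n+m m (suc j))

  shapeEntry : Fin N → Fin N
  shapeEntry i = fromℕ< (shapeValue<N (toℕ<n i))

  shape : Vec (Fin N) N
  shape = tabulate shapeEntry

  valueAt-shape : ∀ {x} → x < N → valueAt shape x ≡ shapeValue x
  valueAt-shape {x} x<N = begin
    valueAt shape x                                    ≡⟨ valueAt-tabulate shapeEntry x<N ⟩
    toℕ (fromℕ< (shapeValue<N (toℕ<n (fromℕ< x<N)))) ≡⟨ toℕ-fromℕ< _ ⟩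
    shapeValue (toℕ (fromℕ< x<N))                     ≡⟨ cong shapeValue (toℕ-fromℕ< x<N) ⟩
    shapeValue x                                       ∎
    where open ≡-Reasoning

  m≤shapeValue : ∀ {x} → x ≤ j → m ≤ shapeValue x
  m≤shapeValue {x} x≤j with comparison x j
  ... | below d _ = m≤n+m m d
  ... | at _      = m≤n+m m j
  ... | above _ e = ⊥-elim (<⇒≱ (above⇒> e) x≤j)

  shapeValue<m : ∀ {x} → j < x → x < N → shapeValue x < m
  shapeValue<m {x} j<x x<N with comparison x j
  ... | below _ e = ⊥-elim (<-asym j<x (below⇒< e))
  ... | at e      = ⊥-elim (<-irrefl (sym e) j<x)
  ... | above y e = valueAt< τ (above⇒offset< e x<N)

  shapeValue<j+m : ∀ {x} → x < j → shapeValue x < j + m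
  shapeValue<j+m {x} x<j with comparison x j
  ... | below d e = +-monoˡ-< m (below⇒gap< e)
  ... | at e      = ⊥-elim (<-irrefl e x<j)
  ... | above _ e = ⊥-elim (<-asym x<j (above⇒> e))

  shapeValue-decreasing : ∀ {x y} → x < y → y < j → shapeValue y < shapeValue x
  shapeValue-decreasing {x} {y} x<y y<j with comparison x j | comparison y j
  ... | below dx ex | below dy ey = +-monoˡ-< m (+-cancelˡ-< y dy dx (subst (_< y + dx) x+dx≡y+dy (+-monoˡ-< dx x<y)))
    where x+dx≡y+dy = suc-injective (trans (sym ex) ey)
  ... | below _ _ | at e      = ⊥-elim (<-irrefl e y<j)
  ... | below _ _ | above _ e = ⊥-elim (<-asym y<j (above⇒> e))
  ... | at e      | _         = ⊥-elim (<-asym y<j (subst (_< y) e x<y))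
  ... | above _ e | _         = ⊥-elim (<-asym (<-trans x<y y<j) (above⇒> e))

  shapeValue-ascent : ∀ {x y} → x < y → y < N → x ≤ j → shapeValue x < shapeValue y → y ≡ j
  shapeValue-ascent {x} {y} x<y y<N x≤j ascent = go (comparison y j)
    where
    go : Comparison y j → y ≡ j
    go (at e)      = e
    go (above _ e) = ⊥-elim (<-asym (shapeValue<m (above⇒> e) y<N) (≤-<-trans (m≤shapeValue x≤j) ascent))
    go (below _ e) = ⊥-elim (<-asym ascent (shapeValue-decreasing x<y (below⇒< e)))

  shapeValue-injective : InjectiveOn τ → ∀ {x y} → x < N → y < N → shapeValue x ≡ shapeValue y → x ≡ y
  shapeValue-injective injτ {x} {y} x<N y<N e with comparison x j | comparison y j
  ... | at ex       | at ey       = trans ex (sym ey)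
  ... | below dx ex | below dy ey = +-cancelʳ-≡ dx x y (trans x+dx≡y+dy (cong (_+_ y) (sym dx≡dy)))
    where
    x+dx≡y+dy = suc-injective (trans (sym ex) ey)
    dx≡dy = +-cancelʳ-≡ m dx dy e
  ... | above yx ex | above yy ey = trans ex (trans (cong (λ z → suc (j + z)) yx≡yy) (sym ey))
    where yx≡yy = injτ yx yy (above⇒offset< ex x<N) (above⇒offset< ey y<N) e
  ... | below _ ex  | at _        = ⊥-elim (<-irrefl e (+-monoˡ-< m (below⇒gap< ex)))
  ... | at _        | below _ ey  = ⊥-elim (<-irrefl (sym e) (+-monoˡ-< m (below⇒gap< ey)))
  ... | below d _   | above yy ey = ⊥-elim (<-irrefl (sym e) (<-≤-trans (valueAt< τ (above⇒offset< ey y<N)) (m≤n+m m d)))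
  ... | above yx ex | below d _   = ⊥-elim (<-irrefl e (<-≤-trans (valueAt< τ (above⇒offset< ex x<N)) (m≤n+m m d)))
  ... | at _        | above yy ey = ⊥-elim (<-irrefl (sym e) (<-≤-trans (valueAt< τ (above⇒offset< ey y<N)) (m≤n+m m j)))
  ... | above yx ex | at _        = ⊥-elim (<-irrefl e (<-≤-trans (valueAt< τ (above⇒offset< ex x<N)) (m≤n+m m j)))

  shape-injective : InjectiveOn τ → InjectiveOn shape
  shape-injective injτ x y x<N y<N e = shapeValue-injective injτ x<N y<N
    (trans (sym (valueAt-shape x<N)) (trans e (valueAt-shape y<N)))

  liftOccurrence : ∀ {K} {σ : Vec ℕ K} → Occurrence σ τ → Occurrence σ shape
  liftOccurrence {σ = σ} o = record
    { pos      = λ a → suc (j + pos a)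
    ; pos<     = λ a → above-pos< (pos< a)
    ; pos-mono = λ a c a<c → s≤s (+-monoʳ-< j (pos-mono a c a<c))
    ; order    = orderIsomorphic-cong σ values order
    }
    where
    open Occurrence o
    values : ∀ a → valueAt τ (pos a) ≡ valueAt shape (suc (j + pos a))
    values a = sym (trans (valueAt-shape (above-pos< (pos< a))) (shapeValue-above refl))

  lowerOccurrence : ∀ {K} {σ : Vec ℕ K} (o : Occurrence σ shape) →
                    (∀ a → j < Occurrence.pos o a) → Occurrence σ τ
  lowerOccurrence {σ = σ} o late = record
    { pos      = offset
    ; pos<     = λ a → above⇒offset< (pos≡ a) (pos< a)
    ; pos-mono = λ a c a<c → ∸-monoˡ-< (pos-mono a c a<c) (late a)
    ; order    = orderIsomorphic-cong σ values order
    }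
    where
    open Occurrence o
    offset : Fin _ → ℕ
    offset a = pos a ∸ suc j
    pos≡ : ∀ a → pos a ≡ suc (j + offset a)
    pos≡ a = sym (m+[n∸m]≡n (late a))
    values : ∀ a → valueAt shape (pos a) ≡ valueAt τ (offset a)
    values a = trans (valueAt-shape (pos< a)) (shapeValue-above (pos≡ a))

  occurrence-ascent : ∀ {K} {σ : Vec ℕ K} (o : Occurrence σ shape) {a c} → a <ᶠ c →
                      Occurrence.pos o a ≤ j → lookup σ a < lookup σ c → Occurrence.pos o c ≡ j
  occurrence-ascent o {a} {c} a<c pos≤j σa<σc = shapeValue-ascent (pos-mono a c a<c) (pos< c) pos≤j
    (subst₂ _<_ (valueAt-shape (pos< a)) (valueAt-shape (pos< c)) (Equivalence.to (order a c) σa<σc))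
    where open Occurrence o

  -- An occurrence starting after j lies inside τ; one starting at or before j must be refuted directly.
  avoidance-lifts : ∀ {K} {σ : Vec ℕ (suc K)} → ¬ Occurrence σ τ →
                    ((o : Occurrence σ shape) → Occurrence.pos o 0F ≤ j → ⊥) → ¬ Occurrence σ shape
  avoidance-lifts ¬τ early o with j <? Occurrence.pos o 0F
  ... | yes j<first = ¬τ (lowerOccurrence o (λ a → <-≤-trans j<first (first≤ pos pos-mono a)))
    where open Occurrence o
  ... | no j≮first  = early o (≮⇒≥ j≮first)

  shape-avoids123 : ¬ Occurrence p123 τ → ¬ Occurrence p123 shape
  shape-avoids123 ¬τ = avoidance-lifts ¬τ early
    where
    early : (o : Occurrence p123 shape) → Occurrence.pos o 0F ≤ j → ⊥
    early o first≤j = <-irrefl (trans pos₁≡j (sym pos₂≡j)) (pos-mono 1F 2F (s≤s (s≤s z≤n)))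
      where
      open Occurrence o
      pos₁≡j = occurrence-ascent o {0F} {1F} (s≤s z≤n) first≤j (s≤s (s≤s z≤n))
      pos₂≡j = occurrence-ascent o {1F} {2F} (s≤s (s≤s z≤n)) (≤-reflexive pos₁≡j) (s≤s (s≤s (s≤s z≤n)))

  shape-avoids132 : ¬ Occurrence p132 τ → ¬ Occurrence p132 shape
  shape-avoids132 ¬τ = avoidance-lifts ¬τ early
    where
    early : (o : Occurrence p132 shape) → Occurrence.pos o 0F ≤ j → ⊥
    early o first≤j = <-irrefl (trans pos₁≡j (sym pos₂≡j)) (pos-mono 1F 2F (s≤s (s≤s z≤n)))
      where
      open Occurrence o
      pos₁≡j = occurrence-ascent o {0F} {1F} (s≤s z≤n) first≤j (s≤s (s≤s z≤n))
      pos₂≡j = occurrence-ascent o {0F} {2F} (s≤s z≤n) first≤j (s≤s (s≤s z≤n))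

  -- The entries b+1 and b+2 of γ force position j to be at least b and to be followed by an entry.
  shape-avoidsγ : ∀ {b} → 1 ≤ b → j < b ⊎ m ≡ 0 → ¬ Occurrence (gamma b) τ → ¬ Occurrence (gamma b) shape
  shape-avoidsγ {suc b′} _ small ¬τ = avoidance-lifts ¬τ early
    where
    b = suc b′
    b<b+2 : b < b + 2
    b<b+2 = m<m+n b (s≤s z≤n)
    b+1<b+2 : b + 1 < b + 2
    b+1<b+2 = +-monoʳ-< b (s≤s (s≤s z≤n))
    iB iB+1 : Fin (b + 2)
    iB   = fromℕ< b<b+2
    iB+1 = fromℕ< b+1<b+2
    toℕ-iB : toℕ iB ≡ b
    toℕ-iB = toℕ-fromℕ< b<b+2
    toℕ-iB+1 : toℕ iB+1 ≡ b + 1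
    toℕ-iB+1 = toℕ-fromℕ< b+1<b+2
    early : (o : Occurrence (gamma b) shape) → Occurrence.pos o 0F ≤ j → ⊥
    early o first≤j = refute small
      where
      open Occurrence o
      posB≡j : pos iB ≡ j
      posB≡j = occurrence-ascent o {0F} {iB} (subst (0 <_) (sym toℕ-iB) (s≤s z≤n)) first≤j
        (subst (suc b <_) (sym (gamma-at b iB toℕ-iB)) (subst (suc b <_) (+-comm 2 b) ≤-refl))
      b≤j : b ≤ j
      b≤j = subst₂ _≤_ toℕ-iB posB≡j (index≤ pos pos-mono iB)
      j<j+m : j < j + m
      j<j+m = s≤s⁻¹ (<-≤-trans (s≤s (subst (_< pos iB+1) posB≡j
                (pos-mono iB iB+1 (subst₂ _<_ (sym toℕ-iB) (sym toℕ-iB+1) (m<m+n b (s≤s z≤n))))))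
                (pos< iB+1))
      refute : j < b ⊎ m ≡ 0 → ⊥
      refute (inj₁ j<b)  = <⇒≱ j<b b≤j
      refute (inj₂ refl) = <-irrefl (sym (+-identityʳ j)) j<j+m

  shape-containsγ : ∀ {b} → b ≤ j → 0 < m → Occurrence (gamma b) shape
  -- γ sits at positions 0, …, b-1, j, j+1.
  shape-containsγ {b} b≤j 0<m =
    occurrence-byRelabelling (gamma b) shape pos pos< mono (gamma-positive b) φ φ-mono values
    where
    e = j ∸ b
    b+e≡j : b + e ≡ j
    b+e≡j = m+[n∸m]≡n b≤j
    posFor : ∀ {x} → Comparison x b → ℕ
    posFor {x} (below _ _) = x
    posFor (at _)          = j
    posFor (above _ _)     = suc j
    pos : Fin (b + 2) → ℕ
    pos a = posFor (comparison (toℕ a) b)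
    suc-j<N : suc j < N
    suc-j<N = s≤s (m<m+n j 0<m)
    pos< : ∀ a → pos a < N
    pos< a with comparison (toℕ a) b
    ... | below _ e′ = <-trans (≤-trans (below⇒< e′) b≤j) j<N
    ... | at _       = j<N
    ... | above _ _  = suc-j<N
    mono : StrictlyIncreasing pos
    mono a c a<c with comparison (toℕ a) b | comparison (toℕ c) b
    ... | below _ _  | below _ _  = a<c
    ... | below _ ea | at _       = ≤-trans (below⇒< ea) b≤j
    ... | below _ ea | above _ _  = s≤s (≤-trans (<⇒≤ (below⇒< ea)) b≤j)
    ... | at _       | above _ _  = ≤-refl
    ... | at ea      | at ec      = ⊥-elim (<-irrefl (trans ea (sym ec)) a<c)
    ... | at ea      | below _ ec = ⊥-elim (<-asym a<c (subst (toℕ c <_) (sym ea) (below⇒< ec)))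
    ... | above _ ea | _          =
      ⊥-elim (<⇒≱ (toℕ<n c) (subst (_≤ toℕ c) (sym (+-comm b 2)) (≤-trans (s≤s (above⇒> ea)) a<c)))
    φ : ℕ → ℕ
    φ 0             = 0
    φ 1             = valueAt τ 0
    φ (suc (suc w)) = w + e + m
    φ-mono : IncreasingFrom1 φ
    φ-mono {1}           {suc (suc w)} _ _                 = <-≤-trans (valueAt< τ 0<m) (m≤n+m m (w + e))
    φ-mono {suc (suc w)} {suc (suc _)} _ (s≤s (s≤s w<w′)) = +-monoˡ-< m (+-monoˡ-< e w<w′)
    φ-mono {1}           {1}           _ (s≤s ())
    values : ∀ a → valueAt shape (pos a) ≡ φ (lookup (gamma b) a)
    values a = trans (valueAt-shape (pos< a)) (go (comparison (toℕ a) b))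
      where
      go : (c : Comparison (toℕ a) b) → shapeValue (posFor c) ≡ φ (lookup (gamma b) a)
      go (below d e′) = trans (shapeValue-below {toℕ a} j≡) (cong φ (sym (gamma-below b a e′)))
        where
        j≡ : j ≡ suc (toℕ a + (d + e))
        j≡ = trans (sym b+e≡j) (trans (cong (_+ e) e′) (cong suc (+-assoc (toℕ a) d e)))
      go (at e′) = begin
        shapeValue j               ≡⟨ shapeValue-at refl ⟩
        j + m                      ≡⟨ cong (_+ m) (sym b+e≡j) ⟩
        φ (suc (suc b))            ≡⟨ cong φ (trans (+-comm 2 b) (sym (gamma-at b a e′))) ⟩
        φ (lookup (gamma b) a)     ∎
        where open ≡-Reasoning
      go (above _ e′) = trans (shapeValue-above (cong suc (sym (+-identityʳ j))))
                              (cong φ (sym (gamma-above b a e′)))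

increasing₃ : ∀ {x y z} → x < y → y < z → StrictlyIncreasing (lookup (x ∷ y ∷ z ∷ []))
increasing₃ x<y y<z 0F 1F _                 = x<y
increasing₃ x<y y<z 0F 2F _                 = <-trans x<y y<z
increasing₃ x<y y<z 1F 2F _                 = y<z
increasing₃ x<y y<z 0F 0F ()
increasing₃ x<y y<z 1F 0F ()
increasing₃ x<y y<z 1F 1F (s≤s ())
increasing₃ x<y y<z 2F 0F ()
increasing₃ x<y y<z 2F 1F (s≤s ())
increasing₃ x<y y<z 2F 2F (s≤s (s≤s ()))

pattern 3+_ k = suc (suc (suc k))

relabel₃ : ℕ → ℕ → ℕ → ℕ → ℕ
relabel₃ u v w 0      = 0
relabel₃ u v w 1      = u
relabel₃ u v w 2      = v
relabel₃ u v w (3+ k) = w + k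

relabel₃-increasing : ∀ {u v w} → u < v → v < w → IncreasingFrom1 (relabel₃ u v w)
relabel₃-increasing u<v v<w {1}    {2}    _ _                        = u<v
relabel₃-increasing u<v v<w {1}    {3+ k} _ _                        = <-≤-trans (<-trans u<v v<w) (m≤m+n _ k)
relabel₃-increasing u<v v<w {2}    {3+ k} _ _                        = <-≤-trans v<w (m≤m+n _ k)
relabel₃-increasing u<v v<w {3+ _} {3+ _} _ (s≤s (s≤s (s≤s k<k′))) = +-monoʳ-< _ k<k′
relabel₃-increasing u<v v<w {1}    {1}    _ (s≤s ())
relabel₃-increasing u<v v<w {2}    {1}    _ (s≤s ())
relabel₃-increasing u<v v<w {2}    {2}    _ (s≤s (s≤s ()))
relabel₃-increasing u<v v<w {3+ _} {1}    _ (s≤s ())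
relabel₃-increasing u<v v<w {3+ _} {2}    _ (s≤s (s≤s ()))

module _ {N} (π : Vec (Fin N) N) {x y z} (x<y : x < y) (y<z : y < z) (z<N : z < N) where

  private
    pos< : ∀ a → lookup (x ∷ y ∷ z ∷ []) a < N
    pos< 0F = <-trans x<y (<-trans y<z z<N)
    pos< 1F = <-trans y<z z<N
    pos< 2F = z<N

  occurrence123 : valueAt π x < valueAt π y → valueAt π y < valueAt π z → Occurrence p123 π
  occurrence123 u<v v<w = occurrence-byRelabelling p123 π _ pos< (increasing₃ x<y y<z)
    (λ { 0F → s≤s z≤n ; 1F → s≤s z≤n ; 2F → s≤s z≤n })
    _ (relabel₃-increasing u<v v<w) (λ { 0F → refl ; 1F → refl ; 2F → sym (+-identityʳ _) })

  occurrence132 : valueAt π x < valueAt π z → valueAt π z < valueAt π y → Occurrence p132 π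
  occurrence132 u<w w<v = occurrence-byRelabelling p132 π _ pos< (increasing₃ x<y y<z)
    (λ { 0F → s≤s z≤n ; 1F → s≤s z≤n ; 2F → s≤s z≤n })
    _ (relabel₃-increasing u<w w<v) (λ { 0F → refl ; 1F → sym (+-identityʳ _) ; 2F → refl })

toFin-or : ∀ {m} → Fin m → ℕ → Fin m
toFin-or {m} default x with x <? m
... | yes x<m = fromℕ< x<m
... | no _    = default

toℕ-toFin-or : ∀ {m} (default : Fin m) {x} → x < m → toℕ (toFin-or default x) ≡ x
toℕ-toFin-or {m} default {x} x<m with x <? m
... | yes x<m′ = toℕ-fromℕ< x<m′
... | no x≮m   = ⊥-elim (x≮m x<m)

-- The fallback of toFin-or is never reached once the entries of π after position j are below m.
suffix : ∀ {N} (j m : ℕ) → Vec (Fin N) N → Vec (Fin m) m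
suffix j m π = tabulate (λ i → toFin-or i (valueAt π (suc (j + toℕ i))))

valueAt-suffix : ∀ {N} j m (π : Vec (Fin N) N) {y} → y < m → valueAt π (suc (j + y)) < m →
                 valueAt (suffix j m π) y ≡ valueAt π (suc (j + y))
valueAt-suffix j m π {y} y<m bounded = begin
  valueAt (suffix j m π) y                  ≡⟨ valueAt-tabulate _ y<m ⟩
  toℕ (toFin-or i (entry (toℕ i)))          ≡⟨ toℕ-toFin-or i (subst (λ z → entry z < m) (sym toℕ-i) bounded) ⟩
  entry (toℕ i)                             ≡⟨ cong entry toℕ-i ⟩
  entry y                                   ∎
  where
  open ≡-Reasoning
  entry : ℕ → ℕ
  entry z = valueAt π (suc (j + z))
  i = fromℕ< y<m
  toℕ-i : toℕ i ≡ y
  toℕ-i = toℕ-fromℕ< y<m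

module MaxDecomposition {b j m} {π : Vec (Fin (suc (j + m))) (suc (j + m))}
                        (av : Avoider b π) (maxAt : valueAt π j ≡ j + m) where

  open Avoider av
  N : ℕ
  N = suc (j + m)

  j<N : j < N
  j<N = s≤s (m≤m+n j m)

  value<max : ∀ {x} → x < N → x ≢ j → valueAt π x < j + m
  value<max {x} x<N x≢j = ≤∧≢⇒< (s≤s⁻¹ (valueAt< π x<N))
    (λ e → x≢j (injective x j x<N j<N (trans e (sym maxAt))))

  decreasing-before : ∀ {x y} → x < y → y < j → valueAt π y < valueAt π x
  decreasing-before {x} {y} x<y y<j with <-cmp (valueAt π x) (valueAt π y)
  ... | tri< vx<vy _ _ = ⊥-elim (avoids123 (occurrence123 π x<y y<j j<N vx<vy
                           (subst (valueAt π y <_) (sym maxAt) (value<max y<N (<⇒≢ y<j)))))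
    where y<N = <-trans y<j j<N
  ... | tri≈ _ vx≡vy _ = ⊥-elim (<⇒≢ x<y (injective x y (<-trans x<y y<N) y<N vx≡vy))
    where y<N = <-trans y<j j<N
  ... | tri> _ _ vy<vx = vy<vx

  after<before : ∀ {x z} → x < j → j < z → z < N → valueAt π z < valueAt π x
  after<before {x} {z} x<j j<z z<N with <-cmp (valueAt π x) (valueAt π z)
  ... | tri< vx<vz _ _ = ⊥-elim (avoids132 (occurrence132 π x<j j<z z<N vx<vz
                           (subst (valueAt π z <_) (sym maxAt) (value<max z<N (≢-sym (<⇒≢ j<z))))))
  ... | tri≈ _ vx≡vz _ = ⊥-elim (<⇒≢ (<-trans x<j j<z) (injective x z (<-trans x<j j<N) z<N vx≡vz))
  ... | tri> _ _ vz<vx = vz<vx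

  value-before≤ : ∀ {x d} → j ≡ suc (x + d) → valueAt π x ≤ d + m
  value-before≤ {zero}  {d} j≡ =
    s≤s⁻¹ (subst (λ k → valueAt π 0 < k + m) j≡ (value<max (s≤s z≤n) (λ 0≡j → 0≢1+n (trans 0≡j j≡))))
  value-before≤ {suc x} {d} j≡ = s≤s⁻¹ (<-≤-trans (decreasing-before ≤-refl (below⇒< j≡))
                                   (value-before≤ {x} {suc d} (trans j≡ (cong suc (sym (+-suc x d))))))

  -- The m entries after j are distinct and all smaller than the entry just before j.
  m≤value-before-max : ∀ {j′} → j ≡ suc j′ → m ≤ valueAt π j′
  m≤value-before-max {j′} j≡ = injectiveOn-bounded⇒≤ π injective (λ y → suc (j + toℕ y))
    (λ e → toℕ-injective (+-cancelˡ-≡ j _ _ (suc-injective e))) (above-pos< ∘ toℕ<n)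
    (λ y → after<before j′<j (s≤s (m≤m+n j (toℕ y))) (above-pos< (toℕ<n y)))
    where
    j′<j : j′ < j
    j′<j = subst (j′ <_) (sym j≡) ≤-refl

  value-before≥ : ∀ {x d} → j ≡ suc (x + d) → d + m ≤ valueAt π x
  value-before≥ {x} {zero}  j≡ = m≤value-before-max (trans j≡ (cong suc (+-identityʳ x)))
  value-before≥ {x} {suc d} j≡ =
    <-≤-trans (s≤s (value-before≥ {suc x} {d} j≡′)) (decreasing-before ≤-refl (below⇒< j≡′))
    where j≡′ = trans j≡ (cong suc (+-suc x d))

  value-before : ∀ {x d} → j ≡ suc (x + d) → valueAt π x ≡ d + m
  value-before j≡ = ≤-antisym (value-before≤ j≡) (value-before≥ j≡)

  value-after<m : ∀ {z} → j < z → z < N → valueAt π z < m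
  value-after<m {z} j<z z<N = go j refl
    where
    go : ∀ k → k ≡ j → valueAt π z < m
    go zero    0≡j = subst (λ k → valueAt π z < k + m) (sym 0≡j) (value<max z<N (≢-sym (<⇒≢ j<z)))
    go (suc k) k+1≡j = subst (valueAt π z <_) (value-before (trans (sym k+1≡j) (cong suc (sym (+-identityʳ k)))))
                         (after<before (subst (k <_) k+1≡j ≤-refl) j<z z<N)

  τ : Vec (Fin m) m
  τ = suffix j m π

  open Shape j m τ using (shape; shapeValue; shapeValue-below; shapeValue-at; shapeValue-above; valueAt-shape; liftOccurrence)

  valueAt-τ : ∀ {y} → y < m → valueAt τ y ≡ valueAt π (suc (j + y))
  valueAt-τ y<m = valueAt-suffix j m π y<m (value-after<m (s≤s (m≤m+n j _)) (above-pos< y<m))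

  value≡shapeValue : ∀ {x} → x < N → valueAt π x ≡ shapeValue x
  value≡shapeValue {x} x<N = go (comparison x j)
    where
    go : Comparison x j → valueAt π x ≡ shapeValue x
    go (below _ e) = trans (value-before e) (sym (shapeValue-below e))
    go (at e)      = trans (cong (valueAt π) e) (trans maxAt (sym (shapeValue-at e)))
    go (above _ e) = trans (cong (valueAt π) e) (trans (sym (valueAt-τ (above⇒offset< e x<N))) (sym (shapeValue-above e)))

  π≡shape : π ≡ shape
  π≡shape = ≡-byValueAt π shape (λ x x<N → trans (value≡shapeValue x<N) (sym (valueAt-shape x<N)))

  τ-avoider : Avoider b τ
  τ-avoider = record
    { injective = λ y y′ y<m y′<m e → +-cancelˡ-≡ j _ _ (suc-injective (injective _ _ (above-pos< y<m) (above-pos< y′<m)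
                    (trans (sym (valueAt-τ y<m)) (trans e (valueAt-τ y′<m)))))
    ; avoids132 = avoids132 ∘ subst (Occurrence p132) (sym π≡shape) ∘ liftOccurrence
    ; avoids123 = avoids123 ∘ subst (Occurrence p123) (sym π≡shape) ∘ liftOccurrence
    ; avoidsγ   = avoidsγ ∘ subst (Occurrence (gamma b)) (sym π≡shape) ∘ liftOccurrence
    }

¬occurrence-[] : ∀ {K} {σ : Vec ℕ K} → Fin K → ¬ Occurrence σ ([] {A = Fin 0})
¬occurrence-[] a o = n≮0 (Occurrence.pos< o a)

[]-avoider : ∀ b → Avoider b ([] {A = Fin 0})
[]-avoider b = record
  { injective = λ _ _ ()
  ; avoids132 = ¬occurrence-[] 0F
  ; avoids123 = ¬occurrence-[] 0F
  ; avoidsγ   = ¬occurrence-[] (fromℕ< (<-≤-trans (s≤s z≤n) (m≤n+m 2 b)))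
  }

shape-avoider : ∀ {b} → 1 ≤ b → ∀ {j m} {τ : Vec (Fin m) m} → Avoider b τ → j < b ⊎ m ≡ 0 →
                Avoider b (Shape.shape j m τ)
shape-avoider 1≤b {j} {m} {τ} av small = record
  { injective = shape-injective injective
  ; avoids132 = shape-avoids132 avoids132
  ; avoids123 = shape-avoids123 avoids123
  ; avoidsγ   = shape-avoidsγ 1≤b small avoidsγ
  }
  where
  open Avoider av
  open Shape j m τ

castPerm : ∀ {a n} → a ≡ n → Vec (Fin (suc a)) (suc a) → Vec (Fin (suc n)) (suc n)
castPerm refl v = v

valueAt-castPerm : ∀ {a n} (e : a ≡ n) (v : Vec (Fin (suc a)) (suc a)) x → valueAt (castPerm e v) x ≡ valueAt v x
valueAt-castPerm refl v x = refl

castPerm-injective : ∀ {a n} (e : a ≡ n) {v w : Vec (Fin (suc a)) (suc a)} → castPerm e v ≡ castPerm e w → v ≡ w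
castPerm-injective refl v≡w = v≡w

avoider-castPerm : ∀ {b a n} (e : a ≡ n) {v : Vec (Fin (suc a)) (suc a)} → Avoider b v → Avoider b (castPerm e v)
avoider-castPerm refl av = av

occurrence-castPerm : ∀ {K a n} {σ : Vec ℕ K} (e : a ≡ n) {v : Vec (Fin (suc a)) (suc a)} →
                      Occurrence σ v → Occurrence σ (castPerm e v)
occurrence-castPerm refl o = o

injectiveOn⇒max : ∀ {n} (π : Vec (Fin (suc n)) (suc n)) → InjectiveOn π → ¬ (∀ x → x < suc n → valueAt π x ≢ n)
injectiveOn⇒max {n} π inj ¬max = <-irrefl refl (injectiveOn-bounded⇒≤ π inj toℕ toℕ-injective toℕ<n
  (λ i → ≤∧≢⇒< (s≤s⁻¹ (valueAt< π (toℕ<n i))) (¬max (toℕ i) (toℕ<n i))))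

≡castShape-suffix : ∀ {b j m n} (e : j + m ≡ n) {π : Vec (Fin (suc n)) (suc n)} → Avoider b π → valueAt π j ≡ n →
                    π ≡ castPerm e (Shape.shape j m (suffix j m π))
≡castShape-suffix refl av maxAt = MaxDecomposition.π≡shape av maxAt

suffix-avoider : ∀ {b j m n} (e : j + m ≡ n) {π : Vec (Fin (suc n)) (suc n)} → Avoider b π → valueAt π j ≡ n →
                 Avoider b (suffix j m π)
suffix-avoider refl av maxAt = MaxDecomposition.τ-avoider av maxAt

module Coding (b : ℕ) (1≤b : 1 ≤ b) (n : ℕ) where

  Perm : Set
  Perm = Vec (Fin (suc n)) (suc n)

  -- Scanning the positions j = n ∸ r, …, n for the maximum; k = b ∸ j counts the positions left at which
  -- the maximum may be followed by a nonempty suffix without creating γ.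
  Code : ℕ → ℕ → Set
  Code k       zero    = ⊤
  Code zero    (suc r) = Code zero r
  Code (suc k) (suc r) = Av b (suc r) ⊎ Code k r

  next : ∀ {j r} → j + suc r ≡ n → suc j + r ≡ n
  next {j} {r} e = trans (sym (+-suc j r)) e

  budget-next : ∀ {k j} → k ≡ b ∸ j → pred k ≡ b ∸ suc j
  budget-next {j = j} k≡ = trans (cong pred k≡) (pred[m∸n]≡m∸[1+n] b j)

  decode : ∀ k r j → j + r ≡ n → Code k r → Perm
  decode k       zero    j e tt       = castPerm e (Shape.shape j 0 [])
  decode zero    (suc r) j e c        = decode zero r (suc j) (next e) c
  decode (suc k) (suc r) j e (inj₁ τ) = castPerm e (Shape.shape j (suc r) (value τ))
  decode (suc k) (suc r) j e (inj₂ c) = decode k r (suc j) (next e) c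

  decode-avoider : ∀ k r j e → k ≡ b ∸ j → (c : Code k r) → Irrelevant (Avoider b (decode k r j e c))
  decode-avoider k       zero    j e _  tt = [ avoider-castPerm e (shape-avoider 1≤b ([]-avoider b) (inj₂ refl)) ]
  decode-avoider zero    (suc r) j e k≡ c  = decode-avoider zero r (suc j) (next e) (budget-next k≡) c
  decode-avoider (suc k) (suc r) j e k≡ (inj₁ (τ , [ inAv ])) =
    [ avoider-castPerm e (shape-avoider 1≤b (inAv⇒avoider b τ inAv) (inj₁ j<b)) ]
    where j<b = m∸n≢0⇒n<m (λ b∸j≡0 → 0≢1+n (trans (sym b∸j≡0) (sym k≡)))
  decode-avoider (suc k) (suc r) j e k≡ (inj₂ c) = decode-avoider k r (suc j) (next e) (budget-next k≡) c

  castShape-before<n : ∀ {j m} (e : j + m ≡ n) (τ : Vec (Fin m) m) {x} → x < j →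
                       valueAt (castPerm e (Shape.shape j m τ)) x < n
  castShape-before<n {j} {m} e τ {x} x<j = begin-strict
    valueAt (castPerm e shape) x ≡⟨ valueAt-castPerm e shape x ⟩
    valueAt shape x              ≡⟨ valueAt-shape (<-trans x<j j<N) ⟩
    shapeValue x                 <⟨ shapeValue<j+m x<j ⟩
    j + m                        ≡⟨ e ⟩
    n                            ∎
    where
    open Shape j m τ
    open ≤-Reasoning

  decode-noMaxBefore : ∀ k r j e (c : Code k r) {x} → x < j → valueAt (decode k r j e c) x ≢ n
  decode-noMaxBefore k       zero    j e tt       x<j = <⇒≢ (castShape-before<n e [] x<j)
  decode-noMaxBefore zero    (suc r) j e c        x<j = decode-noMaxBefore zero r (suc j) (next e) c (m<n⇒m<1+n x<j)
  decode-noMaxBefore (suc k) (suc r) j e (inj₁ τ) x<j = <⇒≢ (castShape-before<n e (value τ) x<j)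
  decode-noMaxBefore (suc k) (suc r) j e (inj₂ c) x<j = decode-noMaxBefore k r (suc j) (next e) c (m<n⇒m<1+n x<j)

  decode-maxAt : ∀ k r j e (τ : Av b (suc r)) → valueAt (decode (suc k) (suc r) j e (inj₁ τ)) j ≡ n
  decode-maxAt k r j e τ = trans (valueAt-castPerm e shape j)
    (trans (valueAt-shape j<N) (trans (shapeValue-at refl) e))
    where open Shape j (suc r) (value τ)

  shape-injectiveˡ : ∀ {j m} {τ τ′ : Vec (Fin m) m} → Shape.shape j m τ ≡ Shape.shape j m τ′ → τ ≡ τ′
  shape-injectiveˡ {j} {m} {τ} {τ′} shape≡ = ≡-byValueAt τ τ′ λ y y<m → begin
    valueAt τ y                            ≡⟨ S.shapeValue-above refl ⟨
    S.shapeValue (suc (j + y))             ≡⟨ S.valueAt-shape (above-pos< y<m) ⟨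
    valueAt S.shape (suc (j + y))          ≡⟨ cong (λ v → valueAt v (suc (j + y))) shape≡ ⟩
    valueAt S′.shape (suc (j + y))         ≡⟨ S′.valueAt-shape (above-pos< y<m) ⟩
    S′.shapeValue (suc (j + y))            ≡⟨ S′.shapeValue-above refl ⟩
    valueAt τ′ y                           ∎
    where
    module S  = Shape j m τ
    module S′ = Shape j m τ′
    open ≡-Reasoning

  decode-injective : ∀ k r j e {c c′ : Code k r} → decode k r j e c ≡ decode k r j e c′ → c ≡ c′
  decode-injective k       zero    j e {tt}      {tt}      _ = refl
  decode-injective zero    (suc r) j e                     d≡ = decode-injective zero r (suc j) (next e) d≡
  decode-injective (suc k) (suc r) j e {inj₁ τ} {inj₁ τ′} d≡ =
    cong inj₁ (value-injective (shape-injectiveˡ (castPerm-injective e d≡)))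
  decode-injective (suc k) (suc r) j e {inj₁ τ} {inj₂ c′} d≡ =
    ⊥-elim (decode-noMaxBefore k r (suc j) (next e) c′ ≤-refl
      (trans (cong (λ v → valueAt v j) (sym d≡)) (decode-maxAt k r j e τ)))
  decode-injective (suc k) (suc r) j e {inj₂ c} {inj₁ τ′} d≡ =
    ⊥-elim (decode-noMaxBefore k r (suc j) (next e) c ≤-refl
      (trans (cong (λ v → valueAt v j) d≡) (decode-maxAt k r j e τ′)))
  decode-injective (suc k) (suc r) j e {inj₂ c} {inj₂ c′} d≡ = cong inj₂ (decode-injective k r (suc j) (next e) d≡)

  encode : ∀ k r j → j + r ≡ n → (π : Perm) → .(Avoider b π) → Code k r
  encode k       zero    j e π av = tt
  encode zero    (suc r) j e π av = encode zero r (suc j) (next e) π av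
  encode (suc k) (suc r) j e π av with valueAt π j ≟ n
  ... | yes maxAt = inj₁ (suffix j (suc r) π , [ avoider⇒inAv b _ (suffix-avoider e av maxAt) ])
  ... | no _      = inj₂ (encode k r (suc j) (next e) π av)

  noMax-extend : ∀ (π : Perm) {j} → (∀ {x} → x < j → valueAt π x ≢ n) → valueAt π j ≢ n →
                 ∀ {x} → x < suc j → valueAt π x ≢ n
  noMax-extend π before notAt {x} x<j+1 with m≤n⇒m<n∨m≡n (s≤s⁻¹ x<j+1)
  ... | inj₁ x<j  = before x<j
  ... | inj₂ refl = notAt

  encode-correct : ∀ k r j e (π : Perm) (av : Avoider b π) → k ≡ b ∸ j → (∀ {x} → x < j → valueAt π x ≢ n) →
                   decode k r j e (encode k r j e π av) ≡ π
  encode-correct k zero j e π av _ before with valueAt π j ≟ n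
  ... | yes maxAt = sym (≡castShape-suffix e av maxAt)
  ... | no notAt  = ⊥-elim (injectiveOn⇒max π (Avoider.injective av)
                      (λ x x<n+1 → noMax-extend π before notAt (subst (x <_) (cong suc n≡j) x<n+1)))
    where n≡j = trans (sym e) (+-identityʳ j)
  encode-correct zero (suc r) j e π av k≡ before with valueAt π j ≟ n
  ... | yes maxAt = ⊥-elim (Avoider.avoidsγ av (subst (Occurrence (gamma b)) (sym (≡castShape-suffix e av maxAt))
                      (occurrence-castPerm e (Shape.shape-containsγ j (suc r) _ (m∸n≡0⇒m≤n (sym k≡)) (s≤s z≤n)))))
  ... | no notAt  = encode-correct zero r (suc j) (next e) π av (budget-next k≡) (noMax-extend π before notAt)
  encode-correct (suc k) (suc r) j e π av k≡ before with valueAt π j ≟ n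
  ... | yes maxAt = sym (≡castShape-suffix e av maxAt)
  ... | no notAt  = encode-correct k r (suc j) (next e) π av (budget-next k≡) (noMax-extend π before notAt)

  toCode : Av b (suc n) → Code b n
  toCode (π , [ inAv ]) = encode b n 0 refl π (inAv⇒avoider b π inAv)

  fromCode : Code b n → Av b (suc n)
  fromCode c = decode b n 0 refl c , Irr.map (avoider⇒inAv b _) (decode-avoider b n 0 refl refl c)

  -- The refinement proof is irrelevant, so the equation is recomputed from decidable equality of vectors.
  decode-toCode : (π : Av b (suc n)) → decode b n 0 refl (toCode π) ≡ value π
  decode-toCode (π , [ inAv ]) = recompute (≡-dec Fin._≟_ _ π)
    (encode-correct b n 0 refl π (inAv⇒avoider b π inAv) refl (λ ()))

  Av↔Code : Av b (suc n) ↔ Code b n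
  Av↔Code = mk↔ₛ′ toCode fromCode
    (λ c → decode-injective b n 0 refl (decode-toCode (fromCode c)))
    (λ π → value-injective (decode-toCode π))

-- placements f k r = 1 + f r + f (r ∸ 1) + ⋯ with min k r terms taken from f.
placements : (ℕ → ℕ) → ℕ → ℕ → ℕ
placements f k       zero    = 1
placements f zero    (suc r) = placements f zero r
placements f (suc k) (suc r) = f (suc r) + placements f k r

placements-cong : ∀ {f g} k r → (∀ {r′} → r′ < r → f (suc r′) ≡ g (suc r′)) →
                  placements f k r ≡ placements g k r
placements-cong k       zero    _   = refl
placements-cong zero    (suc r) f≡g = placements-cong zero r (f≡g ∘ m<n⇒m<1+n)
placements-cong (suc k) (suc r) f≡g = cong₂ _+_ (f≡g ≤-refl) (placements-cong k r (f≡g ∘ m<n⇒m<1+n))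

placements-unique : ∀ {f g} k → (∀ r → f (suc r) ≡ placements f k r) → (∀ r → g (suc r) ≡ placements g k r) →
                    ∀ r → f (suc r) ≡ g (suc r)
placements-unique {f} {g} k f-rec g-rec = <-rec _ λ r ih →
  trans (f-rec r) (trans (placements-cong k r ih) (sym (g-rec r)))

placements-suc : ∀ {f} → f 0 ≡ 0 → ∀ k r → placements f (suc k) r ≡ placements f k r + f (r ∸ k)
placements-suc {f} f0≡0 k zero = sym (trans (cong (λ z → 1 + f z) (0∸n≡0 k)) (cong (_+_ 1) f0≡0))
placements-suc {f} f0≡0 zero (suc r) = +-comm (f (suc r)) (placements f zero r)
placements-suc {f} f0≡0 (suc k) (suc r) = begin
  f (suc r) + placements f (suc k) r          ≡⟨ cong (_+_ (f (suc r))) (placements-suc f0≡0 k r) ⟩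
  f (suc r) + (placements f k r + f (r ∸ k))  ≡⟨ +-assoc (f (suc r)) _ _ ⟨
  f (suc r) + placements f k r + f (r ∸ k)    ∎
  where open ≡-Reasoning

module _ {b : ℕ} {a : ℕ → ℕ} (1≤b : 1 ≤ b) (iso : ∀ n → Fin (a n) ↔ Av b n) where

  Av0↔⊤ : Av b 0 ↔ ⊤
  Av0↔⊤ = mk↔ₛ′ (λ _ → tt) (λ _ → [] , [ avoider⇒inAv b [] ([]-avoider b) ])
    (λ _ → refl) (λ { ([] , _) → refl })

  count-zero : a 0 ≡ 1
  count-zero = ↔⇒≡ (↔-sym 1↔⊤ ↔-∘ (Av0↔⊤ ↔-∘ iso 0))

  count-suc : ∀ n → a (suc n) ≡ placements a b n
  count-suc n = ↔⇒≡ (Code↔Fin b n ↔-∘ (Av↔Code ↔-∘ iso (suc n)))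
    where
    open Coding b 1≤b n
    Code↔Fin : ∀ k r → Code k r ↔ Fin (placements a k r)
    Code↔Fin k       zero    = ↔-sym 1↔⊤
    Code↔Fin zero    (suc r) = Code↔Fin zero r
    Code↔Fin (suc k) (suc r) = ↔-sym +↔⊎ ↔-∘ (↔-sym (iso (suc r)) ⊎-↔ Code↔Fin k r)

module _ (b : ℕ) where

  private
    S : ℕ → ℕ
    S = sumF b

  prefixSum-hist-suc : ∀ k r → sum (take (suc k) (hist b (suc r))) ≡ F b (suc r) + sum (take k (hist b r))
  prefixSum-hist-suc k zero    = refl
  prefixSum-hist-suc k (suc r) = cong (_+ sum (take k (hist b (suc r)))) (sym (+-identityʳ _))

  -- Pointwise, S (r + 1) = S r + F (r + 1), and F b 0 = 0 pads the shorter window.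
  placements-sumF-suc : ∀ k r → placements S k (suc r) ≡ placements S k r + sum (take k (hist b (suc r)))
  placements-sumF-suc zero    r       = sym (+-identityʳ _)
  placements-sumF-suc (suc k) zero    = cong (_+_ 2) (sym (sum-take-[0] k))
    where
    sum-take-[0] : ∀ k → sum (take k (0 List.∷ List.[])) ≡ 0
    sum-take-[0] zero    = refl
    sum-take-[0] (suc zero)    = refl
    sum-take-[0] (suc (suc k)) = refl
  placements-sumF-suc (suc k) (suc r) = begin
    S (suc r) + F b (suc (suc r)) + placements S k (suc r)
      ≡⟨ cong (_+_ (S (suc r) + F b (suc (suc r)))) (placements-sumF-suc k r) ⟩
    S (suc r) + F b (suc (suc r)) + (placements S k r + sum (take k (hist b (suc r))))
      ≡⟨ solve 4 (λ s f p h → s :+ f :+ (p :+ h) := s :+ p :+ (f :+ h)) refl (S (suc r)) (F b (suc (suc r))) _ _ ⟩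
    S (suc r) + placements S k r + (F b (suc (suc r)) + sum (take k (hist b (suc r))))
      ≡⟨ cong (_+_ (S (suc r) + placements S k r)) (sym (prefixSum-hist-suc k (suc r))) ⟩
    S (suc r) + placements S k r + sum (take (suc k) (hist b (suc (suc r))))
      ∎
    where
    open ≡-Reasoning
    open +-*-Solver

  sumF≡placements : ∀ r → sumF b (suc r) ≡ placements S b r
  sumF≡placements zero    = refl
  sumF≡placements (suc r) = begin
    S (suc r) + F b (suc (suc r))                      ≡⟨ cong₂ _+_ (sumF≡placements r) (+-identityʳ _) ⟩
    placements S b r + sum (take b (hist b (suc r)))   ≡⟨ placements-sumF-suc b r ⟨
    placements S b (suc r)                             ∎
    where open ≡-Reasoning

  sumF-recurrence : 1 ≤ b → ∀ n → S (suc (suc n)) + S (suc n ∸ b) ≡ S (suc n) + S (suc n)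
  sumF-recurrence (s≤s {n = b′} z≤n) n = begin
    S (suc (suc n)) + S (n ∸ b′)                      ≡⟨ cong (_+ S (n ∸ b′)) (sumF≡placements (suc n)) ⟩
    S (suc n) + placements S b′ n + S (n ∸ b′)        ≡⟨ +-assoc (S (suc n)) _ _ ⟩
    S (suc n) + (placements S b′ n + S (n ∸ b′))      ≡⟨ cong (_+_ (S (suc n))) (placements-suc refl b′ n) ⟨
    S (suc n) + placements S b n                      ≡⟨ cong (_+_ (S (suc n))) (sumF≡placements n) ⟨
    S (suc n) + S (suc n)                             ∎
    where open ≡-Reasoning

module _ (f : Series) where

  open ℤS.+-*-Solver

  conv-⊕ʳ : ∀ g h i m → conv f (g ⊕ h) i m ≡ conv f g i m ℤ.+ conv f h i m
  conv-⊕ʳ g h zero    m = ℤP.*-distribˡ-+ (f zero) (g m) (h m)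
  conv-⊕ʳ g h (suc i) m rewrite conv-⊕ʳ g h i (suc m) =
    solve 5 (λ x a b c d → x :* (a :+ b) :+ (c :+ d) := (x :* a :+ c) :+ (x :* b :+ d)) refl
      (f (suc i)) (g m) (h m) (conv f g i (suc m)) (conv f h i (suc m))

  conv-⊖ʳ : ∀ g h i m → conv f (g ⊖ h) i m ≡ conv f g i m ℤ.- conv f h i m
  conv-⊖ʳ g h zero    m = solve 3 (λ x a b → x :* (a :- b) := x :* a :- x :* b) refl (f zero) (g m) (h m)
  conv-⊖ʳ g h (suc i) m rewrite conv-⊖ʳ g h i (suc m) =
    solve 5 (λ x a b c d → x :* (a :- b) :+ (c :- d) := (x :* a :+ c) :- (x :* b :+ d)) refl
      (f (suc i)) (g m) (h m) (conv f g i (suc m)) (conv f h i (suc m))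

  conv-scaleʳ : ∀ c g i m → conv f (scale c g) i m ≡ c ℤ.* conv f g i m
  conv-scaleʳ c g zero    m = solve 3 (λ x k a → x :* (k :* a) := k :* (x :* a)) refl (f zero) c (g m)
  conv-scaleʳ c g (suc i) m rewrite conv-scaleʳ c g i (suc m) =
    solve 4 (λ x k a d → x :* (k :* a) :+ k :* d := k :* (x :* a :+ d)) refl (f (suc i)) c (g m) (conv f g i (suc m))

X^-diagonal : ∀ k → X^ k k ≡ ℤ.1ℤ
X^-diagonal zero    = refl
X^-diagonal (suc k) = X^-diagonal k

X^-offDiagonal : ∀ {k m} → k ≢ m → X^ k m ≡ ℤ.0ℤ
X^-offDiagonal {zero}  {zero}  k≢m = ⊥-elim (k≢m refl)
X^-offDiagonal {zero}  {suc m} _   = refl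
X^-offDiagonal {suc k} {zero}  _   = refl
X^-offDiagonal {suc k} {suc m} k≢m = X^-offDiagonal (k≢m ∘ cong suc)

conv-X^-beyond : ∀ f k i {m} → k < m → conv f (X^ k) i m ≡ ℤ.0ℤ
conv-X^-beyond f k zero    k<m rewrite X^-offDiagonal (<⇒≢ k<m) = ℤP.*-zeroʳ (f zero)
conv-X^-beyond f k (suc i) k<m rewrite X^-offDiagonal (<⇒≢ k<m) | conv-X^-beyond f k i (m<n⇒m<1+n k<m) =
  cong (ℤ._+ ℤ.0ℤ) (ℤP.*-zeroʳ (f (suc i)))

-- Multiplying by x^k shifts coefficients; f 0 = 0 absorbs the truncated subtraction.
conv-X^ : ∀ f k i {m} → f 0 ≡ ℤ.0ℤ → m ≤ k → conv f (X^ k) i m ≡ f ((i + m) ∸ k)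
conv-X^ f k zero {m} f0≡0 m≤k with m≤n⇒m<n∨m≡n m≤k
... | inj₁ m<k rewrite X^-offDiagonal (≢-sym (<⇒≢ m<k)) | m≤n⇒m∸n≡0 (<⇒≤ m<k) = trans (ℤP.*-zeroʳ (f zero)) (sym f0≡0)
... | inj₂ refl rewrite X^-diagonal m | n∸n≡0 m = ℤP.*-identityʳ (f zero)
conv-X^ f k (suc i) {m} f0≡0 m≤k with m≤n⇒m<n∨m≡n m≤k
... | inj₁ m<k rewrite X^-offDiagonal (≢-sym (<⇒≢ m<k)) | conv-X^ f k i f0≡0 m<k | +-suc i m =
  trans (cong (ℤ._+ f (suc (i + m) ∸ k)) (ℤP.*-zeroʳ (f (suc i)))) (ℤP.+-identityˡ _)
... | inj₂ refl rewrite X^-diagonal m | conv-X^-beyond f m i (n<1+n m) | m+n∸n≡m (suc i) m =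
  trans (ℤP.+-identityʳ _) (ℤP.*-identityʳ _)

⊛-X^ : ∀ {f} → f 0 ≡ ℤ.0ℤ → ∀ k n → (f ⊛ X^ k) n ≡ f (n ∸ k)
⊛-X^ {f} f0≡0 k n = trans (conv-X^ f k n f0≡0 z≤n) (cong (λ z → f (z ∸ k)) (+-identityʳ n))

⊛-1-2x+x^k : ∀ {f} → f 0 ≡ ℤ.0ℤ → ∀ k n →
             (f ⊛ ((X^ 0 ⊖ scale (+ 2) (X^ 1)) ⊕ X^ k)) n ≡ f n ℤ.- + 2 ℤ.* f (n ∸ 1) ℤ.+ f (n ∸ k)
⊛-1-2x+x^k {f} f0≡0 k n = begin
  conv f ((X^ 0 ⊖ scale (+ 2) (X^ 1)) ⊕ X^ k) n 0
    ≡⟨ conv-⊕ʳ f _ _ n 0 ⟩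
  conv f (X^ 0 ⊖ scale (+ 2) (X^ 1)) n 0 ℤ.+ (f ⊛ X^ k) n
    ≡⟨ cong (ℤ._+ (f ⊛ X^ k) n) (conv-⊖ʳ f _ _ n 0) ⟩
  (f ⊛ X^ 0) n ℤ.- conv f (scale (+ 2) (X^ 1)) n 0 ℤ.+ (f ⊛ X^ k) n
    ≡⟨ cong (λ z → (f ⊛ X^ 0) n ℤ.- z ℤ.+ (f ⊛ X^ k) n) (conv-scaleʳ f (+ 2) _ n 0) ⟩
  (f ⊛ X^ 0) n ℤ.- + 2 ℤ.* (f ⊛ X^ 1) n ℤ.+ (f ⊛ X^ k) n
    ≡⟨ cong₂ (λ u v → u ℤ.- + 2 ℤ.* v ℤ.+ (f ⊛ X^ k) n) (⊛-X^ f0≡0 0 n) (⊛-X^ f0≡0 1 n) ⟩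
  f n ℤ.- + 2 ℤ.* f (n ∸ 1) ℤ.+ (f ⊛ X^ k) n
    ≡⟨ cong (ℤ._+_ (f n ℤ.- + 2 ℤ.* f (n ∸ 1))) (⊛-X^ f0≡0 k n) ⟩
  f n ℤ.- + 2 ℤ.* f (n ∸ 1) ℤ.+ f (n ∸ k)
    ∎
  where open ≡-Reasoning

suc∸[k+1] : ∀ n k → suc n ∸ (k + 1) ≡ n ∸ k
suc∸[k+1] n k = cong (suc n ∸_) (+-comm k 1)

sumF-characteristic : ∀ {b} → 1 ≤ b → ∀ n →
  + sumF b n ℤ.- + 2 ℤ.* + sumF b (n ∸ 1) ℤ.+ + sumF b (n ∸ (b + 1)) ≡ X^ 1 n
sumF-characteristic {b} _ zero rewrite 0∸n≡0 (b + 1) = refl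
sumF-characteristic {b} _ (suc zero) rewrite suc∸[k+1] 0 b | 0∸n≡0 b = refl
sumF-characteristic {b} 1≤b (suc (suc n)) rewrite suc∸[k+1] (suc n) b =
  balanced (sumF b (suc (suc n))) (sumF b (suc n ∸ b)) (sumF b (suc n)) (sumF-recurrence b 1≤b n)
  where
  open ℤS.+-*-Solver
  balanced : ∀ x y z → x + y ≡ z + z → + x ℤ.- + 2 ℤ.* + z ℤ.+ + y ≡ ℤ.0ℤ
  balanced x y z x+y≡z+z = begin
    + x ℤ.- + 2 ℤ.* + z ℤ.+ + y
      ≡⟨ solve 3 (λ x y z → x :- con (+ 2) :* z :+ y := (x :+ y) :- (z :+ z)) refl (+ x) (+ y) (+ z) ⟩
    (+ x ℤ.+ + y) ℤ.- (+ z ℤ.+ + z)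
      ≡⟨ cong₂ ℤ._-_ (ℤP.pos-+ x y) (ℤP.pos-+ z z) ⟨
    + (x + y) ℤ.- + (z + z)
      ≡⟨ cong (λ w → + w ℤ.- + (z + z)) x+y≡z+z ⟩
    + (z + z) ℤ.- + (z + z)
      ≡⟨ ℤP.+-inverseʳ (+ (z + z)) ⟩
    ℤ.0ℤ
      ∎
    where open ≡-Reasoning

mainTheorem7 : (b : ℕ) → 1 ≤ b →
    (a : ℕ → ℕ) → (∀ n → Fin (a n) ↔ Av b n) →
    (∀ n → 1 ≤ n → a n ≡ sumF b n)
    × (∀ n → ((ofℕ a ⊖ X^ 0) ⊛ ((X^ 0 ⊖ scale (+ 2) (X^ 1)) ⊕ X^ (b + 1))) n ≡ X^ 1 n)
mainTheorem7 b 1≤b a iso = counts , generatingFunction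
  where
  a≡sumF : ∀ n → a (suc n) ≡ sumF b (suc n)
  a≡sumF = placements-unique b (count-suc 1≤b iso) (sumF≡placements b)

  counts : ∀ n → 1 ≤ n → a n ≡ sumF b n
  counts (suc n) _ = a≡sumF n

  coefficients : ∀ n → (ofℕ a ⊖ X^ 0) n ≡ + sumF b n
  coefficients zero    = cong (λ c → + c ℤ.- ℤ.1ℤ) (count-zero 1≤b iso)
  coefficients (suc n) = trans (ℤP.+-identityʳ (+ a (suc n))) (cong +_ (a≡sumF n))

  generatingFunction : ∀ n → ((ofℕ a ⊖ X^ 0) ⊛ ((X^ 0 ⊖ scale (+ 2) (X^ 1)) ⊕ X^ (b + 1))) n ≡ X^ 1 n
  generatingFunction n = begin
    ((ofℕ a ⊖ X^ 0) ⊛ ((X^ 0 ⊖ scale (+ 2) (X^ 1)) ⊕ X^ (b + 1))) n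
      ≡⟨ ⊛-1-2x+x^k (coefficients 0) (b + 1) n ⟩
    f n ℤ.- + 2 ℤ.* f (n ∸ 1) ℤ.+ f (n ∸ (b + 1))
      ≡⟨ cong₂ ℤ._+_ (cong₂ (λ u v → u ℤ.- + 2 ℤ.* v) (coefficients n) (coefficients (n ∸ 1)))
                     (coefficients (n ∸ (b + 1))) ⟩
    + sumF b n ℤ.- + 2 ℤ.* + sumF b (n ∸ 1) ℤ.+ + sumF b (n ∸ (b + 1))
      ≡⟨ sumF-characteristic 1≤b n ⟩
    X^ 1 n
      ∎
    where
    f = ofℕ a ⊖ X^ 0
    open ≡-Reasoning
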